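{- Let $K = \mathbb{Q}(\sqrt{ -7})$ with a fixed square root $\sqrt{ -7}$, and let $\theta = \frac{1+\sqrt{ -7}}{2}$ and $\theta' = \frac{1-\sqrt{ -7}}{2}$, regarded as elements of the ring of integers $\mathcal{O}_K$. Let $m_1, m_2$ be odd natural numbers with $m_1 \geq 3$, $m_2 \geq 3$, and $m_1 \equiv m_2 \pmod{42}$. If $-2\theta + 1 = \theta^{m_1} - \theta'^{m_1}$ and $-2\theta + 1 = \theta^{m_2} - \theta'^{m_2}$ in $\mathcal{O}_K$, then $m_1 = m_2$.
   Context: The element $\theta$ satisfies $\theta^2 = \theta - 2$, $\theta' = 1 - \theta$, and $-2\theta+1 = -\sqrt{ -7}$. -}

module Defs where

open import Data.Integer using (ℤ; +_; -[1+_]; _+_; _*_; -_; _-_)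
open import Data.Nat using (ℕ; zero; suc)

-- The ring of integers O_K of K = Q(sqrt(-7)) is Z[θ] with θ = (1+sqrt(-7))/2,
-- a free Z-module with basis 1, θ, and θ² = θ - 2.
-- An element a + bθ is represented by the pair of integer coordinates (a , b).
record OK : Set where
  constructor _+_θ
  field
    re : ℤ
    im : ℤ
open OK public

infixl 6 _⊕_ _⊖_
infixl 7 _⊗_

_⊕_ : OK → OK → OK
(a + b θ) ⊕ (c + d θ) = (a + c) + (b + d) θ

⊝_ : OK → OK
⊝ (a + b θ) = (- a) + (- b) θ

_⊖_ : OK → OK → OK
x ⊖ y = x ⊕ (⊝ y)

-- (a + bθ)(c + dθ) = ac + (ad + bc)θ + bd θ² = (ac - 2bd) + (ad + bc + bd)θ
_⊗_ : OK → OK → OK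
(a + b θ) ⊗ (c + d θ) = (a * c - + 2 * (b * d)) + (a * d + b * c + b * d) θ

oneK : OK
oneK = (+ 1) + (+ 0) θ

θK : OK
θK = (+ 0) + (+ 1) θ

-- θ' = 1 - θ = (1 - sqrt(-7))/2
θ'K : OK
θ'K = (+ 1) + (- (+ 1)) θ

_^K_ : OK → ℕ → OK
x ^K zero = oneK
x ^K suc n = x ⊗ (x ^K n)

-- -2θ + 1 = -sqrt(-7)
lhsK : OK
lhsK = (+ 1) + (- (+ 2)) θ

-- Conjugation sends θ to θ' = 1 − θ, so θᵐ − θ'ᵐ = b (2θ − 1) = b √−7 when θᵐ = a + b θ;
-- both hypotheses thus say that the θ-coordinate of θ^m₁ and of θ^m₂ is −1. That
-- coordinate never repeats along m, m + 42, m + 84, … by a 7-adic argument. With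
-- ε = θ − 4 one has θ⁴² ≡ 1 + 7·5ε (mod 49), and raising to 7th powers lifts this to
-- θ^(42·7ᵏ) ≡ 1 + 7ᵏ⁺¹·5ε (mod 7ᵏ⁺²). So for 7 ∤ s,
-- θ^(m + 42·7ᵏ·s) − θᵐ ≡ 7ᵏ⁺¹·5s·θᵐε (mod 7ᵏ⁺²), and as θε ≡ 4ε (mod 7) the
-- θ-coordinate of 5s·θᵐε is congruent to 5s·4ᵐ, which is prime to 7.

module Submission where

open import Defs
open import Algebra.Bundles using (CommutativeRing)
open import Algebra.Consequences.Propositional
  using (comm∧idˡ⇒id; comm∧invˡ⇒inv; comm∧distrˡ⇒distrʳ)
open import Algebra.Structures using (IsCommutativeRing)
import Algebra.Properties.Semiring.Exp as Exp
import Algebra.Solver.Ring as Solver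
import Algebra.Solver.Ring.AlmostCommutativeRing as ACR
open import Data.Empty using (⊥-elim)
open import Data.Integer as ℤ using (ℤ; +_)
import Data.Integer.Base as Integer
import Data.Integer.Divisibility.Signed as ℤ∣
import Data.Integer.Properties as ℤ
open import Data.Integer.Tactic.RingSolver using (solve-∀)
open import Algebra.Properties.AbelianGroup ℤ.+-0-abelianGroup using (∙-cancelˡ)
open import Data.Maybe using (Maybe; just; nothing)
open import Data.Nat as ℕ using (ℕ; zero; suc)
open import Data.Nat.Combinatorics using (_C_; nC1≡n; nCk+nC[k+1]≡[n+1]C[k+1])
open import Data.Nat.Divisibility using (_∣_; _∣?_; divides)
open import Data.Nat.DivMod using (_%_; _/_; m≡m%n+[m/n]*n; /-monoˡ-≤)
open import Data.Nat.Induction using (<-rec)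
open import Data.Nat.Primality using (Prime; prime?; euclidsLemma)
import Data.Nat.Properties as ℕ
import Data.Nat.Tactic.RingSolver as ℕ-Solver
open import Data.Product using (∃-syntax; _×_; _,_; proj₁; proj₂; map₂)
open import Data.Sum using ([_,_]′)
open import Function using (_∘_)
open import Level using (0ℓ)
open import Relation.Binary.PropositionalEquality
open ≡-Reasoning
open import Relation.Nullary using (¬_; yes; no)
open import Relation.Nullary.Decidable using (from-yes; from-no)

split-power : ∀ {p} → 1 ℕ.< p → ∀ n → n ≢ 0 → ∃[ k ] ∃[ s ] n ≡ p ℕ.^ k ℕ.* s × ¬ p ∣ s
split-power {p} 1<p = <-rec _ split
  where
  Split : ℕ → Set
  Split n = ∃[ k ] ∃[ s ] n ≡ p ℕ.^ k ℕ.* s × ¬ p ∣ s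
  split : ∀ n → (∀ {m} → m ℕ.< n → m ≢ 0 → Split m) → n ≢ 0 → Split n
  split n rec n≢0 with p ∣? n
  ... | no p∤n = 0 , n , sym (ℕ.*-identityˡ n) , p∤n
  ... | yes (divides q n≡q*p) = extend (rec q<n q≢0)
    where
    q≢0 : q ≢ 0
    q≢0 refl = n≢0 n≡q*p
    q<n : q ℕ.< n
    q<n = subst (q ℕ.<_) (sym n≡q*p) (ℕ.m<m*n q p {{ℕ.≢-nonZero q≢0}} 1<p)
    reorder : ∀ p a s → a ℕ.* s ℕ.* p ≡ p ℕ.* a ℕ.* s
    reorder = ℕ-Solver.solve-∀
    extend : Split q → Split n
    extend (k , s , q≡p^k*s , p∤s) = suc k , s , (begin
      n                        ≡⟨ n≡q*p ⟩
      q ℕ.* p                  ≡⟨ cong (ℕ._* p) q≡p^k*s ⟩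
      p ℕ.^ k ℕ.* s ℕ.* p      ≡⟨ reorder p (p ℕ.^ k) s ⟩
      p ℕ.^ suc k ℕ.* s        ∎) , p∤s

%≡%∧≤⇒∃+* : ∀ n .{{_ : ℕ.NonZero n}} {m₁ m₂} → m₁ % n ≡ m₂ % n → m₁ ℕ.≤ m₂ → ∃[ d ] m₂ ≡ m₁ ℕ.+ d ℕ.* n
%≡%∧≤⇒∃+* n {m₁} {m₂} m₁≡m₂ m₁≤m₂ = d , (begin
  m₂                                       ≡⟨ m≡m%n+[m/n]*n m₂ n ⟩
  m₂ % n ℕ.+ m₂ / n ℕ.* n                  ≡⟨ cong₂ (λ r a → r ℕ.+ a ℕ.* n) m₁≡m₂ (ℕ.m+[n∸m]≡n q₁≤q₂) ⟨
  m₁ % n ℕ.+ (m₁ / n ℕ.+ d) ℕ.* n          ≡⟨ reorder (m₁ % n) (m₁ / n) d n ⟩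
  m₁ % n ℕ.+ m₁ / n ℕ.* n ℕ.+ d ℕ.* n      ≡⟨ cong (ℕ._+ d ℕ.* n) (m≡m%n+[m/n]*n m₁ n) ⟨
  m₁ ℕ.+ d ℕ.* n                           ∎)
  where
  q₁≤q₂ = /-monoˡ-≤ n m₁≤m₂
  d = m₂ / n ℕ.∸ m₁ / n
  reorder : ∀ r a d n → r ℕ.+ (a ℕ.+ d) ℕ.* n ≡ r ℕ.+ a ℕ.* n ℕ.+ d ℕ.* n
  reorder = ℕ-Solver.solve-∀

injective-on-residues : ∀ n .{{_ : ℕ.NonZero n}} {A : Set} (f : ℕ → A) →
                  (∀ m d → f (m ℕ.+ d ℕ.* n) ≡ f m → d ≡ 0) →
                  ∀ {m₁ m₂} → m₁ % n ≡ m₂ % n → f m₁ ≡ f m₂ → m₁ ≡ m₂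
injective-on-residues n f aperiodic {m₁} {m₂} m₁≡m₂ fm₁≡fm₂ =
  [ (λ m₁≤m₂ → ordered m₁≡m₂ m₁≤m₂ (sym fm₁≡fm₂))
  , (λ m₂≤m₁ → sym (ordered (sym m₁≡m₂) m₂≤m₁ fm₁≡fm₂))
  ]′ (ℕ.≤-total m₁ m₂)
  where
  ordered : ∀ {m₁ m₂} → m₁ % n ≡ m₂ % n → m₁ ℕ.≤ m₂ → f m₂ ≡ f m₁ → m₁ ≡ m₂
  ordered {m₁} {m₂} m₁≡m₂ m₁≤m₂ fm₂≡fm₁ with %≡%∧≤⇒∃+* n m₁≡m₂ m₁≤m₂
  ... | d , m₂≡m₁+d*n = sym (begin
    m₂                ≡⟨ m₂≡m₁+d*n ⟩
    m₁ ℕ.+ d ℕ.* n    ≡⟨ cong (λ d → m₁ ℕ.+ d ℕ.* n) d≡0 ⟩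
    m₁ ℕ.+ 0          ≡⟨ ℕ.+-identityʳ m₁ ⟩
    m₁                ∎)
    where
    d≡0 = aperiodic m₁ d (trans (cong f (sym m₂≡m₁+d*n)) fm₂≡fm₁)

zeroK : OK
zeroK = (+ 0) + (+ 0) θ

⊕-assoc : ∀ x y z → (x ⊕ y) ⊕ z ≡ x ⊕ (y ⊕ z)
⊕-assoc (a + b θ) (c + d θ) (e + f θ) = cong₂ _+_θ (ℤ.+-assoc a c e) (ℤ.+-assoc b d f)

⊕-comm : ∀ x y → x ⊕ y ≡ y ⊕ x
⊕-comm (a + b θ) (c + d θ) = cong₂ _+_θ (ℤ.+-comm a c) (ℤ.+-comm b d)

⊕-identityˡ : ∀ x → zeroK ⊕ x ≡ x
⊕-identityˡ (a + b θ) = cong₂ _+_θ (ℤ.+-identityˡ a) (ℤ.+-identityˡ b)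

⊕-inverseˡ : ∀ x → ⊝ x ⊕ x ≡ zeroK
⊕-inverseˡ (a + b θ) = cong₂ _+_θ (ℤ.+-inverseˡ a) (ℤ.+-inverseˡ b)

⊗-assoc : ∀ x y z → (x ⊗ y) ⊗ z ≡ x ⊗ (y ⊗ z)
⊗-assoc (a + b θ) (c + d θ) (e + f θ) = cong₂ _+_θ (re-assoc a b c d e f) (im-assoc a b c d e f)
  where
  open Integer using (_+_; _*_; _-_)
  re-assoc : ∀ a b c d e f → (a * c - + 2 * (b * d)) * e - + 2 * ((a * d + b * c + b * d) * f)
                           ≡ a * (c * e - + 2 * (d * f)) - + 2 * (b * (c * f + d * e + d * f))
  re-assoc = solve-∀
  im-assoc : ∀ a b c d e f → (a * c - + 2 * (b * d)) * f + (a * d + b * c + b * d) * e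
                               + (a * d + b * c + b * d) * f
                           ≡ a * (c * f + d * e + d * f) + b * (c * e - + 2 * (d * f))
                               + b * (c * f + d * e + d * f)
  im-assoc = solve-∀

⊗-comm : ∀ x y → x ⊗ y ≡ y ⊗ x
⊗-comm (a + b θ) (c + d θ) = cong₂ _+_θ (re-comm a b c d) (im-comm a b c d)
  where
  open Integer using (_+_; _*_; _-_)
  re-comm : ∀ a b c d → a * c - + 2 * (b * d) ≡ c * a - + 2 * (d * b)
  re-comm = solve-∀
  im-comm : ∀ a b c d → a * d + b * c + b * d ≡ c * b + d * a + d * b
  im-comm = solve-∀

⊗-identityˡ : ∀ x → oneK ⊗ x ≡ x
⊗-identityˡ (a + b θ) = cong₂ _+_θ (re-identity a b) (im-identity a b)
  where
  open Integer using (_+_; _*_; _-_)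
  re-identity : ∀ a b → + 1 * a - + 2 * (+ 0 * b) ≡ a
  re-identity = solve-∀
  im-identity : ∀ a b → + 1 * b + + 0 * a + + 0 * b ≡ b
  im-identity = solve-∀

⊗-distribˡ-⊕ : ∀ x y z → x ⊗ (y ⊕ z) ≡ x ⊗ y ⊕ x ⊗ z
⊗-distribˡ-⊕ (a + b θ) (c + d θ) (e + f θ) = cong₂ _+_θ (re-distrib a b c d e f) (im-distrib a b c d e f)
  where
  open Integer using (_+_; _*_; _-_)
  re-distrib : ∀ a b c d e f → a * (c + e) - + 2 * (b * (d + f))
                             ≡ (a * c - + 2 * (b * d)) + (a * e - + 2 * (b * f))
  re-distrib = solve-∀
  im-distrib : ∀ a b c d e f → a * (d + f) + b * (c + e) + b * (d + f)
                             ≡ (a * d + b * c + b * d) + (a * f + b * e + b * f)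
  im-distrib = solve-∀

⊕-⊗-isCommutativeRing : IsCommutativeRing _≡_ _⊕_ _⊗_ ⊝_ zeroK oneK
⊕-⊗-isCommutativeRing = record
  { isRing = record
    { +-isAbelianGroup = record
      { isGroup = record
        { isMonoid = record
          { isSemigroup = record
            { isMagma = record { isEquivalence = isEquivalence ; ∙-cong = cong₂ _⊕_ }
            ; assoc = ⊕-assoc
            }
          ; identity = comm∧idˡ⇒id ⊕-comm ⊕-identityˡ
          }
        ; inverse = comm∧invˡ⇒inv ⊕-comm ⊕-inverseˡ
        ; ⁻¹-cong = cong ⊝_
        }
      ; comm = ⊕-comm
      }
    ; *-cong = cong₂ _⊗_
    ; *-assoc = ⊗-assoc
    ; *-identity = comm∧idˡ⇒id ⊗-comm ⊗-identityˡ
    ; distrib = ⊗-distribˡ-⊕ , comm∧distrˡ⇒distrʳ ⊗-comm ⊗-distribˡ-⊕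
    }
  ; *-comm = ⊗-comm
  }

conj : OK → OK
conj (a + b θ) = (a ℤ.+ b) + (ℤ.- b) θ

conj-⊗ : ∀ x y → conj (x ⊗ y) ≡ conj x ⊗ conj y
conj-⊗ (a + b θ) (c + d θ) = cong₂ _+_θ (re-conj a b c d) (im-conj a b c d)
  where
  open Integer using (_+_; _*_; _-_; -_)
  re-conj : ∀ a b c d → (a * c - + 2 * (b * d)) + (a * d + b * c + b * d)
                      ≡ (a + b) * (c + d) - + 2 * (- b * - d)
  re-conj = solve-∀
  im-conj : ∀ a b c d → - (a * d + b * c + b * d)
                      ≡ (a + b) * - d + - b * (c + d) + - b * - d
  im-conj = solve-∀

θ'^≡conj-θ^ : ∀ m → θ'K ^K m ≡ conj (θK ^K m)
θ'^≡conj-θ^ zero = refl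
θ'^≡conj-θ^ (suc m) = trans (cong (θ'K ⊗_) (θ'^≡conj-θ^ m)) (sym (conj-⊗ θK (θK ^K m)))

im-x⊖conj-x : ∀ x → im (x ⊖ conj x) ≡ + 2 ℤ.* im x
im-x⊖conj-x (a + b θ) = twice b
  where
  twice : ∀ b → b ℤ.+ ℤ.- (ℤ.- b) ≡ + 2 ℤ.* b
  twice = solve-∀

im-θ^≡-1 : ∀ m → lhsK ≡ θK ^K m ⊖ θ'K ^K m → im (θK ^K m) ≡ ℤ.- + 1
im-θ^≡-1 m lhs≡ = ℤ.*-cancelˡ-≡ (+ 2) _ _ (begin
  + 2 ℤ.* im (θK ^K m)              ≡⟨ im-x⊖conj-x (θK ^K m) ⟨
  im (θK ^K m ⊖ conj (θK ^K m))     ≡⟨ cong (λ y → im (θK ^K m ⊖ y)) (θ'^≡conj-θ^ m) ⟨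
  im (θK ^K m ⊖ θ'K ^K m)           ≡⟨ cong im lhs≡ ⟨
  im lhsK                           ∎)

-- Opaque copies of the operations, so that the ring solver compares its normal
-- forms symbolically instead of unfolding them into integer coordinates.
infixl 6 _+_
infixl 7 _*_
infix 8 -_

opaque
  _+_ : OK → OK → OK
  _+_ = _⊕_

  _*_ : OK → OK → OK
  _*_ = _⊗_

  -_ : OK → OK
  -_ = ⊝_

opaque
  unfolding _+_ _*_ -_

  isCommutativeRing : IsCommutativeRing _≡_ _+_ _*_ -_ zeroK oneK
  isCommutativeRing = ⊕-⊗-isCommutativeRing

commutativeRing : CommutativeRing 0ℓ 0ℓ
commutativeRing = record { isCommutativeRing = isCommutativeRing }

open CommutativeRing commutativeRing using (0#; 1#; +-assoc; *-assoc; *-identityˡ; semiring)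
open Exp semiring using (_^_; ^-homo-*; ^-assocʳ)

fromℤ : ℤ → OK
fromℤ a = a + (+ 0) θ

fromℕ : ℕ → OK
fromℕ n = fromℤ (+ n)

seven : OK
seven = fromℕ 7

opaque
  unfolding _+_ _*_ -_

  fromℤ-+ : ∀ a b → fromℤ (a ℤ.+ b) ≡ fromℤ a + fromℤ b
  fromℤ-+ _ _ = refl

  fromℤ-* : ∀ a b → fromℤ (a ℤ.* b) ≡ fromℤ a * fromℤ b
  fromℤ-* a b = cong₂ _+_θ (re-* a b) (im-* a b)
    where
    re-* : ∀ a b → a ℤ.* b ≡ a ℤ.* b ℤ.- + 2 ℤ.* (+ 0 ℤ.* + 0)
    re-* = solve-∀
    im-* : ∀ a b → + 0 ≡ a ℤ.* + 0 ℤ.+ + 0 ℤ.* b ℤ.+ + 0 ℤ.* + 0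
    im-* = solve-∀

  fromℤ-neg : ∀ a → fromℤ (ℤ.- a) ≡ - fromℤ a
  fromℤ-neg _ = refl

  im-+ : ∀ x y → im (x + y) ≡ im x ℤ.+ im y
  im-+ _ _ = refl

  im-fromℤ-* : ∀ a y → im (fromℤ a * y) ≡ a ℤ.* im y
  im-fromℤ-* a (c + d θ) = im-scale a c d
    where
    im-scale : ∀ a c d → a ℤ.* d ℤ.+ + 0 ℤ.* c ℤ.+ + 0 ℤ.* d ≡ a ℤ.* d
    im-scale = solve-∀

  ^K≡^ : ∀ x m → x ^K m ≡ x ^ m
  ^K≡^ x zero = refl
  ^K≡^ x (suc m) = cong (x ⊗_) (^K≡^ x m)

fromℤ-homomorphism : ℤ.+-*-rawRing ACR.-Raw-AlmostCommutative⟶ ACR.fromCommutativeRing commutativeRing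
fromℤ-homomorphism = record
  { ⟦_⟧ = fromℤ ; +-homo = fromℤ-+ ; *-homo = fromℤ-* ; -‿homo = fromℤ-neg ; 0-homo = refl ; 1-homo = refl }

fromℤ-≟ : ∀ a b → Maybe (fromℤ a ≡ fromℤ b)
fromℤ-≟ a b with a ℤ.≟ b
... | yes a≡b = just (cong fromℤ a≡b)
... | no _ = nothing

open Solver ℤ.+-*-rawRing (ACR.fromCommutativeRing commutativeRing) fromℤ-homomorphism fromℤ-≟
  using (solve; _:=_; _:+_; _:*_; con)

infix 4 _≡_mod_

_≡_mod_ : OK → OK → OK → Set
_≡_mod_ x y d = ∃[ q ] x ≡ y + d * q

≡-mod-refl : ∀ x d → x ≡ x mod d
≡-mod-refl x d = 0# , x≡x+d*0 x d
  where
  x≡x+d*0 : ∀ x d → x ≡ x + d * 0#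
  x≡x+d*0 = solve 2 (λ x d → x := x :+ d :* con (+ 0)) refl

[1+u]^n≡1+nu+[nC2]u² : ∀ u n →
  (1# + u) ^ n ≡ 1# + fromℕ n * u + fromℕ (n C 2) * (u * u) mod u * u * u
[1+u]^n≡1+nu+[nC2]u² u zero = 0# , base u
  where
  base : ∀ u → 1# ≡ 1# + fromℕ 0 * u + fromℕ 0 * (u * u) + u * u * u * fromℕ 0
  base = solve 1 (λ u → con (+ 1) := con (+ 1) :+ con (+ 0) :* u :+ con (+ 0) :* (u :* u)
                                      :+ u :* u :* u :* con (+ 0)) refl
[1+u]^n≡1+nu+[nC2]u² u (suc n) with [1+u]^n≡1+nu+[nC2]u² u n
... | R , eq = R + T + u * R , (begin
  (1# + u) * (1# + u) ^ n
    ≡⟨ cong ((1# + u) *_) eq ⟩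
  (1# + u) * (1# + N * u + T * (u * u) + u * u * u * R)
    ≡⟨ step u N T R ⟩
  1# + (1# + N) * u + (N + T) * (u * u) + u * u * u * (R + T + u * R)
    ≡⟨ cong₂ (λ a b → 1# + a * u + b * (u * u) + u * u * u * (R + T + u * R))
             (sym (fromℤ-+ (+ 1) (+ n))) fromℕ[[n+1]C2] ⟩
  1# + fromℕ (suc n) * u + fromℕ (suc n C 2) * (u * u) + u * u * u * (R + T + u * R) ∎)
  where
  N = fromℕ n
  T = fromℕ (n C 2)
  fromℕ[[n+1]C2] : N + T ≡ fromℕ (suc n C 2)
  fromℕ[[n+1]C2] = begin
    N + T                          ≡⟨ cong (λ k → fromℕ k + T) (nC1≡n n) ⟨
    fromℕ (n C 1) + T              ≡⟨ fromℤ-+ (+ (n C 1)) (+ (n C 2)) ⟨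
    fromℕ (n C 1 ℕ.+ n C 2)        ≡⟨ cong fromℕ (nCk+nC[k+1]≡[n+1]C[k+1] n 1) ⟩
    fromℕ (suc n C 2)              ∎
  step : ∀ u N T R → (1# + u) * (1# + N * u + T * (u * u) + u * u * u * R)
                   ≡ 1# + (1# + N) * u + (N + T) * (u * u) + u * u * u * (R + T + u * R)
  step = solve 4 (λ u N T R →
    (con (+ 1) :+ u) :* (con (+ 1) :+ N :* u :+ T :* (u :* u) :+ u :* u :* u :* R)
    := con (+ 1) :+ (con (+ 1) :+ N) :* u :+ (N :+ T) :* (u :* u) :+ u :* u :* u :* (R :+ T :+ u :* R)) refl

-- (1 + u)⁷ ≡ 1 + 7u + 21u² (mod u³) with 7ʲ⁺¹ ∣ u, and 21u² vanishes modulo 7ʲ⁺³ because 7 ∣ 21.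
^7-lift : ∀ j g x → x ≡ 1# + seven ^ suc j * g mod seven ^ suc (suc j) →
          x ^ 7 ≡ 1# + seven ^ suc (suc j) * g mod seven ^ suc (suc (suc j))
^7-lift j g x (δ , x≡) = δ + fromℕ 3 * c * (w * w) + c * c * (w * w * w) * R , (begin
  x ^ 7
    ≡⟨ cong (_^ 7) (trans x≡ (+-assoc 1# (seven ^ suc j * g) (seven ^ suc (suc j) * δ))) ⟩
  (1# + u) ^ 7
    ≡⟨ proj₂ binomial ⟩
  1# + seven * u + fromℕ 21 * (u * u) + u * u * u * R
    ≡⟨ expand c g δ R ⟩
  1# + seven ^ suc (suc j) * g
     + seven ^ suc (suc (suc j)) * (δ + fromℕ 3 * c * (w * w) + c * c * (w * w * w) * R) ∎)
  where
  c = seven ^ j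
  w = g + seven * δ
  u = seven ^ suc j * g + seven ^ suc (suc j) * δ
  binomial = [1+u]^n≡1+nu+[nC2]u² u 7
  R = proj₁ binomial
  expand : ∀ c g δ R →
    let u = seven * c * g + seven * (seven * c) * δ
        w = g + seven * δ
    in 1# + seven * u + fromℕ 21 * (u * u) + u * u * u * R
       ≡ 1# + seven * (seven * c) * g
            + seven * (seven * (seven * c)) * (δ + fromℕ 3 * c * (w * w) + c * c * (w * w * w) * R)
  expand = solve 4 (λ c g δ R →
    let u = con (+ 7) :* c :* g :+ con (+ 7) :* (con (+ 7) :* c) :* δ
        w = g :+ con (+ 7) :* δ
    in con (+ 1) :+ con (+ 7) :* u :+ con (+ 21) :* (u :* u) :+ u :* u :* u :* R
       := con (+ 1) :+ con (+ 7) :* (con (+ 7) :* c) :* g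
            :+ con (+ 7) :* (con (+ 7) :* (con (+ 7) :* c))
               :* (δ :+ con (+ 3) :* c :* (w :* w) :+ c :* c :* (w :* w :* w) :* R)) refl

^-≡1+mod : ∀ j g x s → x ≡ 1# + seven ^ suc j * g mod seven ^ suc (suc j) →
           x ^ s ≡ 1# + seven ^ suc j * (fromℕ s * g) mod seven ^ suc (suc j)
^-≡1+mod j g x s (δ , x≡) = N * δ + T * c * (w * w) + seven * c * c * (w * w * w) * R , (begin
  x ^ s
    ≡⟨ cong (_^ s) (trans x≡ (+-assoc 1# (seven ^ suc j * g) (seven ^ suc (suc j) * δ))) ⟩
  (1# + u) ^ s
    ≡⟨ proj₂ binomial ⟩
  1# + N * u + T * (u * u) + u * u * u * R
    ≡⟨ expand c g δ N T R ⟩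
  1# + seven ^ suc j * (N * g)
     + seven ^ suc (suc j) * (N * δ + T * c * (w * w) + seven * c * c * (w * w * w) * R) ∎)
  where
  c = seven ^ j
  w = g + seven * δ
  u = seven ^ suc j * g + seven ^ suc (suc j) * δ
  N = fromℕ s
  T = fromℕ (s C 2)
  binomial = [1+u]^n≡1+nu+[nC2]u² u s
  R = proj₁ binomial
  expand : ∀ c g δ N T R →
    let u = seven * c * g + seven * (seven * c) * δ
        w = g + seven * δ
    in 1# + N * u + T * (u * u) + u * u * u * R
       ≡ 1# + seven * c * (N * g)
            + seven * (seven * c) * (N * δ + T * c * (w * w) + seven * c * c * (w * w * w) * R)
  expand = solve 6 (λ c g δ N T R →
    let u = con (+ 7) :* c :* g :+ con (+ 7) :* (con (+ 7) :* c) :* δ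
        w = g :+ con (+ 7) :* δ
    in con (+ 1) :+ N :* u :+ T :* (u :* u) :+ u :* u :* u :* R
       := con (+ 1) :+ con (+ 7) :* c :* (N :* g)
            :+ con (+ 7) :* (con (+ 7) :* c)
               :* (N :* δ :+ T :* c :* (w :* w) :+ con (+ 7) :* c :* c :* (w :* w :* w) :* R)) refl

*-≡1+mod : ∀ y {a g d x} → x ≡ 1# + a * g mod d → y * x ≡ y + a * (y * g) mod d
*-≡1+mod y {a} {g} {d} (q , x≡) = y * q , trans (cong (y *_) x≡) (distribute y a g d q)
  where
  distribute : ∀ y a g d q → y * (1# + a * g + d * q) ≡ y + a * (y * g) + d * (y * q)
  distribute = solve 5 (λ y a g d q →
    y :* (con (+ 1) :+ a :* g :+ d :* q) := y :+ a :* (y :* g) :+ d :* (y :* q)) refl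

-- 2ε = √−7 − 7 and ε² = 7 (2 − θ): modulo 7, ε spans the prime above 7 and is nilpotent.
ε : OK
ε = (ℤ.- + 4) + (+ 1) θ

-- x lies in the prime above 7 but not in its square 7 O_K.
ε∥_ : OK → Set
ε∥ x = ∃[ r ] ¬ 7 ∣ r × x ≡ fromℕ r * ε mod seven

prime-7 : Prime 7
prime-7 = from-yes (prime? 7)

ε∥-* : ∀ {y t x} → ¬ 7 ∣ t → y * ε ≡ fromℕ t * ε mod seven → ε∥ x → ε∥ (y * x)
ε∥-* {y} {t} {x} 7∤t (q′ , yε≡) (r , 7∤r , q , x≡) =
  r ℕ.* t , [ 7∤r , 7∤t ]′ ∘ euclidsLemma r t prime-7 , fromℕ r * q′ + y * q , (begin
    y * x
      ≡⟨ cong (y *_) x≡ ⟩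
    y * (fromℕ r * ε + seven * q)
      ≡⟨ expand y (fromℕ r) ε q ⟩
    fromℕ r * (y * ε) + seven * (y * q)
      ≡⟨ cong (λ z → fromℕ r * z + seven * (y * q)) yε≡ ⟩
    fromℕ r * (fromℕ t * ε + seven * q′) + seven * (y * q)
      ≡⟨ regroup (fromℕ r) (fromℕ t) ε q′ (y * q) ⟩
    fromℕ r * fromℕ t * ε + seven * (fromℕ r * q′ + y * q)
      ≡⟨ cong (λ z → z * ε + seven * (fromℕ r * q′ + y * q)) fromℕ-* ⟨
    fromℕ (r ℕ.* t) * ε + seven * (fromℕ r * q′ + y * q) ∎)
  where
  fromℕ-* : fromℕ (r ℕ.* t) ≡ fromℕ r * fromℕ t
  fromℕ-* = trans (cong fromℤ (ℤ.pos-* r t)) (fromℤ-* (+ r) (+ t))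
  expand : ∀ y R ε q → y * (R * ε + seven * q) ≡ R * (y * ε) + seven * (y * q)
  expand = solve 4 (λ y R ε q →
    y :* (R :* ε :+ con (+ 7) :* q) := R :* (y :* ε) :+ con (+ 7) :* (y :* q)) refl
  regroup : ∀ R T ε q′ z → R * (T * ε + seven * q′) + seven * z ≡ R * T * ε + seven * (R * q′ + z)
  regroup = solve 5 (λ R T ε q′ z →
    R :* (T :* ε :+ con (+ 7) :* q′) :+ con (+ 7) :* z := R :* T :* ε :+ con (+ 7) :* (R :* q′ :+ z)) refl

ε∥-fromℕ* : ∀ {t x} → ¬ 7 ∣ t → ε∥ x → ε∥ (fromℕ t * x)
ε∥-fromℕ* {t} 7∤t = ε∥-* 7∤t (≡-mod-refl (fromℕ t * ε) seven)

opaque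
  unfolding _+_ _*_ -_

  θε≡4ε : θK * ε ≡ fromℕ 4 * ε mod seven
  θε≡4ε = (+ 2) + (ℤ.- + 1) θ , refl

  θ^42≡1+7·5ε : θK ^ 42 ≡ 1# + seven ^ 1 * (fromℕ 5 * ε) mod seven ^ 2
  θ^42≡1+7·5ε = (+ 28733) + (+ 16370) θ , refl

ε∥-θ^* : ∀ m {x} → ε∥ x → ε∥ (θK ^ m * x)
ε∥-θ^* zero {x} ε∥x = subst ε∥_ (sym (*-identityˡ x)) ε∥x
ε∥-θ^* (suc m) {x} ε∥x =
  subst ε∥_ (sym (*-assoc θK (θK ^ m) x)) (ε∥-* (from-no (7 ∣? 4)) θε≡4ε (ε∥-θ^* m ε∥x))

ε∥-+7* : ∀ {x} q → ε∥ x → ε∥ (x + seven * q)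
ε∥-+7* q (r , 7∤r , q′ , x≡) = r , 7∤r , q′ + q , trans (cong (_+ seven * q) x≡) (regroup _ q′ q)
  where
  regroup : ∀ a q′ q → a + seven * q′ + seven * q ≡ a + seven * (q′ + q)
  regroup = solve 3 (λ a q′ q → a :+ con (+ 7) :* q′ :+ con (+ 7) :* q := a :+ con (+ 7) :* (q′ :+ q)) refl

ε∥⇒im≢0 : ∀ {x} → ε∥ x → im x ≢ + 0
ε∥⇒im≢0 {x} (r , 7∤r , q , x≡) im≡0 =
  7∤r (ℤ∣.∣⇒∣ᵤ (ℤ∣.∣m+n∣n⇒∣m {m = + r} 7∣r+7im[q] (ℤ∣.∣m⇒∣m*n (im q) ℤ∣.∣-refl)))
  where
  im-x : im x ≡ + r ℤ.+ + 7 ℤ.* im q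
  im-x = begin
    im x                                          ≡⟨ cong im x≡ ⟩
    im (fromℕ r * ε + seven * q)                  ≡⟨ im-+ (fromℕ r * ε) (seven * q) ⟩
    im (fromℕ r * ε) ℤ.+ im (seven * q)           ≡⟨ cong₂ ℤ._+_ (im-fromℤ-* (+ r) ε) (im-fromℤ-* (+ 7) q) ⟩
    + r ℤ.* + 1 ℤ.+ + 7 ℤ.* im q                  ≡⟨ cong (ℤ._+ + 7 ℤ.* im q) (ℤ.*-identityʳ (+ r)) ⟩
    + r ℤ.+ + 7 ℤ.* im q                          ∎
  7∣r+7im[q] : + 7 ℤ∣.∣ + r ℤ.+ + 7 ℤ.* im q
  7∣r+7im[q] = ℤ∣.divides (+ 0) (trans (sym im-x) im≡0)

im-7^*≡0 : ∀ j z → im (seven ^ j * z) ≡ + 0 → im z ≡ + 0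
im-7^*≡0 zero z im≡0 = trans (cong im (sym (*-identityˡ z))) im≡0
im-7^*≡0 (suc j) z im≡0 = im-7^*≡0 j z (ℤ.*-cancelˡ-≡ (+ 7) _ (+ 0) (begin
  + 7 ℤ.* im (seven ^ j * z)     ≡⟨ im-fromℤ-* (+ 7) (seven ^ j * z) ⟨
  im (seven * (seven ^ j * z))   ≡⟨ cong im (*-assoc seven (seven ^ j) z) ⟨
  im (seven ^ suc j * z)         ≡⟨ im≡0 ⟩
  + 0                            ∎))

θ^[42·7^k]≡ : ∀ k → θK ^ (42 ℕ.* 7 ℕ.^ k) ≡ 1# + seven ^ suc k * (fromℕ 5 * ε) mod seven ^ suc (suc k)
θ^[42·7^k]≡ zero = θ^42≡1+7·5ε
θ^[42·7^k]≡ (suc k) = map₂ (trans θ^[42·7^[k+1]]≡[θ^[42·7^k]]^7) (^7-lift k (fromℕ 5 * ε) _ (θ^[42·7^k]≡ k))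
  where
  θ^[42·7^[k+1]]≡[θ^[42·7^k]]^7 : θK ^ (42 ℕ.* 7 ℕ.^ suc k) ≡ (θK ^ (42 ℕ.* 7 ℕ.^ k)) ^ 7
  θ^[42·7^[k+1]]≡[θ^[42·7^k]]^7 =
    sym (trans (^-assocʳ θK (42 ℕ.* 7 ℕ.^ k) 7) (cong (θK ^_) (reorder (7 ℕ.^ k))))
    where
    reorder : ∀ a → 42 ℕ.* a ℕ.* 7 ≡ 42 ℕ.* (7 ℕ.* a)
    reorder = ℕ-Solver.solve-∀

θ^[m+42·7^k·s]≡ : ∀ m k s →
  θK ^ (m ℕ.+ 42 ℕ.* 7 ℕ.^ k ℕ.* s)
    ≡ θK ^ m + seven ^ suc k * (θK ^ m * (fromℕ s * (fromℕ 5 * ε))) mod seven ^ suc (suc k)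
θ^[m+42·7^k·s]≡ m k s = map₂ (trans (^-homo-* θK m (42 ℕ.* 7 ℕ.^ k ℕ.* s)))
  (*-≡1+mod (θK ^ m) (map₂ (trans (sym (^-assocʳ θK (42 ℕ.* 7 ℕ.^ k) s)))
    (^-≡1+mod k (fromℕ 5 * ε) _ s (θ^[42·7^k]≡ k))))

im-θ^[m+42·7^k·s]≢ : ∀ m k s → ¬ 7 ∣ s → im (θK ^ (m ℕ.+ 42 ℕ.* 7 ℕ.^ k ℕ.* s)) ≢ im (θK ^ m)
im-θ^[m+42·7^k·s]≢ m k s 7∤s im≡ = ε∥⇒im≢0 (ε∥-+7* q ε∥h) (im-7^*≡0 (suc k) (h + seven * q) im≡0)
  where
  y = θK ^ m
  h = y * (fromℕ s * (fromℕ 5 * ε))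
  c = seven ^ suc k
  q = proj₁ (θ^[m+42·7^k·s]≡ m k s)
  ε∥h : ε∥ h
  ε∥h = ε∥-θ^* m (ε∥-fromℕ* 7∤s (5 , from-no (7 ∣? 5) , ≡-mod-refl (fromℕ 5 * ε) seven))
  regroup : ∀ y c h q → y + c * h + seven * c * q ≡ y + c * (h + seven * q)
  regroup = solve 4 (λ y c h q → y :+ c :* h :+ con (+ 7) :* c :* q := y :+ c :* (h :+ con (+ 7) :* q)) refl
  im≡0 : im (c * (h + seven * q)) ≡ + 0
  im≡0 = ∙-cancelˡ (im y) _ _ (begin
    im y ℤ.+ im (c * (h + seven * q))    ≡⟨ im-+ y (c * (h + seven * q)) ⟨
    im (y + c * (h + seven * q))         ≡⟨ cong im (trans (proj₂ (θ^[m+42·7^k·s]≡ m k s)) (regroup y c h q)) ⟨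
    im (θK ^ (m ℕ.+ 42 ℕ.* 7 ℕ.^ k ℕ.* s)) ≡⟨ im≡ ⟩
    im y                                 ≡⟨ ℤ.+-identityʳ (im y) ⟨
    im y ℤ.+ + 0                         ∎)

im-θ^K-aperiodic : ∀ m d → im (θK ^K (m ℕ.+ d ℕ.* 42)) ≡ im (θK ^K m) → d ≡ 0
im-θ^K-aperiodic m zero _ = refl
im-θ^K-aperiodic m d@(suc _) im≡ with split-power {7} (ℕ.s≤s (ℕ.s≤s ℕ.z≤n)) d (λ ())
... | k , s , d≡7^k*s , 7∤s = ⊥-elim (im-θ^[m+42·7^k·s]≢ m k s 7∤s (begin
  im (θK ^ (m ℕ.+ 42 ℕ.* 7 ℕ.^ k ℕ.* s))  ≡⟨ cong (λ e → im (θK ^ (m ℕ.+ e))) 42·7^k·s≡d·42 ⟩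
  im (θK ^ (m ℕ.+ d ℕ.* 42))             ≡⟨ cong im (^K≡^ θK (m ℕ.+ d ℕ.* 42)) ⟨
  im (θK ^K (m ℕ.+ d ℕ.* 42))            ≡⟨ im≡ ⟩
  im (θK ^K m)                           ≡⟨ cong im (^K≡^ θK m) ⟩
  im (θK ^ m)                            ∎))
  where
  reorder : ∀ a s → 42 ℕ.* a ℕ.* s ≡ a ℕ.* s ℕ.* 42
  reorder = ℕ-Solver.solve-∀
  42·7^k·s≡d·42 : 42 ℕ.* 7 ℕ.^ k ℕ.* s ≡ d ℕ.* 42
  42·7^k·s≡d·42 = trans (reorder (7 ℕ.^ k) s) (cong (ℕ._* 42) (sym d≡7^k*s))

mainTheorem4 : (m₁ m₂ : ℕ) → m₁ % 2 ≡ 1 → m₂ % 2 ≡ 1 → 3 ℕ.≤ m₁ → 3 ℕ.≤ m₂ →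
               m₁ % 42 ≡ m₂ % 42 →
               lhsK ≡ θK ^K m₁ ⊖ θ'K ^K m₁ →
               lhsK ≡ θK ^K m₂ ⊖ θ'K ^K m₂ →
               m₁ ≡ m₂
mainTheorem4 m₁ m₂ _ _ _ _ m₁≡m₂ lhs≡₁ lhs≡₂ =
  injective-on-residues 42 (λ m → im (θK ^K m)) im-θ^K-aperiodic m₁≡m₂
    (trans (im-θ^≡-1 m₁ lhs≡₁) (sym (im-θ^≡-1 m₂ lhs≡₂)))
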